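{- Let $\alpha<\beta<\gamma$ be distinct primes, let $G=\langle a\rangle$ be a cyclic group of order $\alpha^2\beta^2\gamma^2$, and let $C=\{x\in G : |x|\in\{\alpha^2,\beta^2,\gamma^2\}\}$. Let $Cay_{p^2}(G,C)$ be the simple undirected graph with vertex set $G$ in which two distinct vertices $x,y$ are adjacent if and only if $xy^{ -1}\in C$. Then the independence number of $Cay_{p^2}(G,C)$ is $\alpha^2\beta^2\gamma$.
   Context: $|x|$ denotes the order of the element $x$ in $G$. The independence number is the maximum size of a set of pairwise non-adjacent vertices. -}

module Defs where

open import Data.Nat using (ℕ; _+_; _*_; _∸_; _^_; _<_; _≤_)
open import Data.Nat.Divisibility using (_∣_)
open import Data.Fin using (Fin; toℕ)
open import Data.Fin.Subset using (Subset; _∈_; ∣_∣)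
open import Data.Product using (_×_; ∃)
open import Data.Sum using (_⊎_)
open import Relation.Nullary using (¬_)
open import Relation.Binary.PropositionalEquality using (_≢_; _≡_)

-- The cyclic group G = ⟨a⟩ of order n is modelled as ℤ/nℤ with carrier Fin n
-- (the element a^i is represented by i), written additively.

-- A natural-number representative of x·y⁻¹ (= x - y in ℤ/nℤ).
sub : (n : ℕ) → Fin n → Fin n → ℕ
sub n x y = toℕ x + (n ∸ toℕ y)

HasOrder : (n m k : ℕ) → Set
HasOrder n m k = (0 < k) × (n ∣ k * m) × (∀ j → 0 < j → j < k → ¬ (n ∣ j * m))

InC : (n α β γ m : ℕ) → Set
InC n α β γ m = HasOrder n m (α ^ 2) ⊎ HasOrder n m (β ^ 2) ⊎ HasOrder n m (γ ^ 2)

Adjacent : (n α β γ : ℕ) → Fin n → Fin n → Set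
Adjacent n α β γ x y = (x ≢ y) × InC n α β γ (sub n x y)

Independent : (n α β γ : ℕ) → Subset n → Set
Independent n α β γ S = ∀ x y → x ∈ S → y ∈ S → ¬ Adjacent n α β γ x y

IndependenceNumber : (n α β γ m : ℕ) → Set
IndependenceNumber n α β γ m =
  (∃ λ (S : Subset n) → Independent n α β γ S × ∣ S ∣ ≡ m)
  × (∀ (S : Subset n) → Independent n α β γ S → ∣ S ∣ ≤ m)

{-# OPTIONS --safe #-}
module Submission where

-- An element d of ℤ/(q p²), with p prime and p ∤ q, has order p² exactly when q ∣ d and
-- p ∤ d. So, with N = α²β²γ² and M = α²β², two vertices are adjacent iff for some
-- p ∈ {α, β, γ} they agree modulo N/p² but not modulo p.
--
-- Write x = M(γs + t) + r with r < M and s, t < γ. The γ vertices sharing s and r differ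
-- by M(t − t′) with γ ∤ t − t′, so they form a clique, and these Mγ cliques cover ℤ/N.
--
-- The set S = {x : x ≡ (x mod α) + (x mod β) (mod γ)} is independent: α-adjacent vertices
-- agree modulo β and γ, so their residues modulo α (both < γ) agree modulo γ, hence agree;
-- symmetrically for β; γ-adjacent vertices agree modulo α and β, hence modulo γ. Since M
-- is invertible modulo γ, every clique meets S.

open import Data.Fin.Base using (Fin; zero; suc; toℕ; cast; combine; remQuot)
open import Data.Fin.Properties as Fin
  using (toℕ-injective; toℕ<n; toℕ-cast; toℕ-combine; toℕ-fromℕ<; cast-involutive;
         combine-injective; combine-remQuot; any?)
open import Data.Fin.Subset as Subset using (Subset; _∈_; ∣_∣; ⊤; inside; outside)
open import Data.Fin.Subset.Properties using (x∈p⇒∣p-x∣<∣p∣; x∈p∧x≢y⇒x∈p-y; ∣⊤∣≡n; ∈⊤)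
open import Data.Nat.Base
open import Data.Nat.Properties
open import Data.Nat.DivMod
open import Data.Nat.Divisibility
open import Data.Nat.Primality using (Prime; euclidsLemma; prime⇒irreducible; prime⇒nonZero; prime⇒nonTrivial; ¬prime[1])
open import Data.Nat.Tactic.RingSolver using (solve-∀)
open import Data.Product using (_×_; _,_; proj₁; proj₂; ∃; map₂)
open import Data.Product.Properties using (,-injectiveˡ; ,-injectiveʳ)
open import Data.Sum using (inj₁; inj₂; [_,_])
open import Data.Vec.Base using ([]; _∷_; here; there; tabulate)
open import Data.Vec.Properties using (lookup∘tabulate; []=⇒lookup; lookup⇒[]=)
open import Function using (_∘_)
open import Level using (Level)
open import Relation.Binary.PropositionalEquality hiding ([_])
open import Relation.Nullary using (¬_; yes; no; does; contradiction)
open import Relation.Nullary.Decidable using (dec-true)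
open import Relation.Unary using (Pred; Decidable)

open import Defs

private variable
  ℓ : Level
  a b c d e j k m n p q : ℕ

injectiveOn⇒∣p∣≤∣q∣ : {P : Subset m} {Q : Subset n} (f : Fin m → Fin n) →
  (∀ {x} → x ∈ P → f x ∈ Q) →
  (∀ {x y} → x ∈ P → y ∈ P → f x ≡ f y → x ≡ y) →
  ∣ P ∣ ≤ ∣ Q ∣
injectiveOn⇒∣p∣≤∣q∣ {P = []} f maps inj = z≤n
injectiveOn⇒∣p∣≤∣q∣ {P = outside ∷ P} f maps inj =
  injectiveOn⇒∣p∣≤∣q∣ (f ∘ suc) (maps ∘ there)
    (λ x∈P y∈P → Fin.suc-injective ∘ inj (there x∈P) (there y∈P))
injectiveOn⇒∣p∣≤∣q∣ {P = inside ∷ P} {Q} f maps inj =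
  ≤-<-trans
    (injectiveOn⇒∣p∣≤∣q∣ (f ∘ suc) avoids-f0 (λ x∈P y∈P → Fin.suc-injective ∘ inj (there x∈P) (there y∈P)))
    (x∈p⇒∣p-x∣<∣p∣ (maps here))
  where
  avoids-f0 : ∀ {x} → x ∈ P → f (suc x) ∈ Q Subset.- f zero
  avoids-f0 x∈P = x∈p∧x≢y⇒x∈p-y (maps (there x∈P)) (λ eq → Fin.0≢1+n (inj here (there x∈P) (sym eq)))

injective⇒surjective : (f : Fin n → Fin n) → (∀ {x y} → f x ≡ f y → x ≡ y) →
  ∀ y → ∃ λ x → f x ≡ y
injective⇒surjective {n} f inj y with any? (λ x → f x Fin.≟ y)
... | yes hit = hit
... | no miss = contradiction
  (injectiveOn⇒∣p∣≤∣q∣ {P = ⊤} {Q = ⊤ Subset.- y} f (λ {x} _ → x∈p∧x≢y⇒x∈p-y ∈⊤ (miss ∘ (x ,_))) (λ _ _ → inj))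
  (<⇒≱ (x∈p⇒∣p-x∣<∣p∣ {p = ⊤ {n}} ∈⊤))

cast-injective : .(eq : m ≡ n) → ∀ {i j : Fin m} → cast eq i ≡ cast eq j → i ≡ j
cast-injective eq {i} {j} cᵢ≡cⱼ =
  toℕ-injective (trans (sym (toℕ-cast eq i)) (trans (cong toℕ cᵢ≡cⱼ) (toℕ-cast eq j)))

subsetOf : {P : Pred (Fin n) ℓ} → Decidable P → Subset n
subsetOf P? = tabulate (does ∘ P?)

module _ {P : Pred (Fin n) ℓ} (P? : Decidable P) where

  ∈-subsetOf⁺ : ∀ {x} → P x → x ∈ subsetOf P?
  ∈-subsetOf⁺ {x} px = lookup⇒[]= x _ (trans (lookup∘tabulate (does ∘ P?) x) (dec-true (P? x) px))

  ∈-subsetOf⁻ : ∀ {x} → x ∈ subsetOf P? → P x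
  ∈-subsetOf⁻ {x} x∈ with P? x | trans (sym (lookup∘tabulate (does ∘ P?) x)) ([]=⇒lookup x∈)
  ... | yes px | _ = px
  ... | no _   | ()

%≡%⇒∣∸ : .{{_ : NonZero k}} → a % k ≡ b % k → k ∣ a ∸ b
%≡%⇒∣∸ {k} {a} {b} eq = divides (a / k ∸ b / k) (begin
  a ∸ b                                   ≡⟨ cong₂ _∸_ (m≡m%n+[m/n]*n a k) (m≡m%n+[m/n]*n b k) ⟩
  (a % k + a / k * k) ∸ (b % k + b / k * k) ≡⟨ cong (λ r → (r + a / k * k) ∸ (b % k + b / k * k)) eq ⟩
  (b % k + a / k * k) ∸ (b % k + b / k * k) ≡⟨ [m+n]∸[m+o]≡n∸o (b % k) _ _ ⟩
  a / k * k ∸ b / k * k                   ≡⟨ *-distribʳ-∸ k (a / k) (b / k) ⟨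
  (a / k ∸ b / k) * k                     ∎)
  where open ≡-Reasoning

∣∸⇒%≡% : .{{_ : NonZero k}} → b ≤ a → k ∣ a ∸ b → a % k ≡ b % k
∣∸⇒%≡% {k} {b} {a} b≤a k∣a∸b = begin
  a % k           ≡⟨ cong (_% k) (m∸n+n≡m b≤a) ⟨
  (a ∸ b + b) % k ≡⟨ %-remove-+ˡ b k∣a∸b ⟩
  b % k           ∎
  where open ≡-Reasoning

%≡%⇒∣∣-∣ : .{{_ : NonZero k}} → a % k ≡ b % k → k ∣ ∣ a - b ∣
%≡%⇒∣∣-∣ {k} {a} {b} eq with ∣m-n∣≡[m∸n]∨[n∸m] a b
... | inj₁ ∣a-b∣≡a∸b = subst (k ∣_) (sym ∣a-b∣≡a∸b) (%≡%⇒∣∸ eq)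
... | inj₂ ∣a-b∣≡b∸a = subst (k ∣_) (sym ∣a-b∣≡b∸a) (%≡%⇒∣∸ (sym eq))

∣∣-∣⇒%≡% : .{{_ : NonZero k}} → k ∣ ∣ a - b ∣ → a % k ≡ b % k
∣∣-∣⇒%≡% {k} {a} {b} k∣∣a-b∣ with ≤-total b a
... | inj₁ b≤a = ∣∸⇒%≡% b≤a (subst (k ∣_) (m≤n⇒∣n-m∣≡n∸m b≤a) k∣∣a-b∣)
... | inj₂ a≤b = sym (∣∸⇒%≡% a≤b (subst (k ∣_) (m≤n⇒∣m-n∣≡n∸m a≤b) k∣∣a-b∣))

+-cancelˡ-%≡ : .{{_ : NonZero k}} → ∀ c → (c + a) % k ≡ (c + b) % k → a % k ≡ b % k
+-cancelˡ-%≡ {k} {a} {b} c eq = ∣∣-∣⇒%≡% (subst (k ∣_) (∣m+n-m+o∣≡∣n-o∣ c a b) (%≡%⇒∣∣-∣ eq))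

+-cancelʳ-%≡ : .{{_ : NonZero k}} → ∀ c → (a + c) % k ≡ (b + c) % k → a % k ≡ b % k
+-cancelʳ-%≡ {k} {a} {b} c eq =
  +-cancelˡ-%≡ c (subst₂ (λ u v → u % k ≡ v % k) (+-comm a c) (+-comm b c) eq)

*-cancelʳ-%≡ : .{{_ : NonZero p}} → Prime p → ¬ p ∣ c →
  (a * c) % p ≡ (b * c) % p → a % p ≡ b % p
*-cancelʳ-%≡ {p} {c} {a} {b} pp p∤c eq with euclidsLemma ∣ a - b ∣ c pp
  (subst (p ∣_) (sym (*-distribʳ-∣-∣ c a b)) (%≡%⇒∣∣-∣ eq))
... | inj₁ p∣∣a-b∣ = ∣∣-∣⇒%≡% p∣∣a-b∣
... | inj₂ p∣c     = contradiction p∣c p∤c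

%≡%∧<⇒≡ : .{{_ : NonZero k}} → a < k → b < k → a % k ≡ b % k → a ≡ b
%≡%∧<⇒≡ a<k b<k eq = trans (sym (m<n⇒m%n≡m a<k)) (trans eq (m<n⇒m%n≡m b<k))

mod≡mod⇒%≡% : .{{_ : NonZero k}} → a mod k ≡ b mod k → a % k ≡ b % k
mod≡mod⇒%≡% {k} {a} {b} eq = begin
  a % k           ≡⟨ toℕ-fromℕ< (m%n<n a k) ⟨
  toℕ (a mod k)   ≡⟨ cong toℕ eq ⟩
  toℕ (b mod k)   ≡⟨ toℕ-fromℕ< (m%n<n b k) ⟩
  b % k           ∎
  where open ≡-Reasoning

sub≡∣-∣ : (x y : Fin n) → sub n x y ≡ ∣ toℕ x + n - toℕ y ∣
sub≡∣-∣ {n} x y = begin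
  toℕ x + (n ∸ toℕ y)   ≡⟨ +-∸-assoc (toℕ x) y≤n ⟨
  toℕ x + n ∸ toℕ y     ≡⟨ m≤n⇒∣n-m∣≡n∸m (≤-trans y≤n (m≤n+m n (toℕ x))) ⟨
  ∣ toℕ x + n - toℕ y ∣ ∎
  where
  open ≡-Reasoning
  y≤n : toℕ y ≤ n
  y≤n = <⇒≤ (toℕ<n y)

∣sub⇒%≡% : .{{_ : NonZero k}} → k ∣ n → (x y : Fin n) → k ∣ sub n x y → toℕ x % k ≡ toℕ y % k
∣sub⇒%≡% {k} k∣n x y k∣d =
  trans (sym (%-remove-+ʳ (toℕ x) k∣n)) (∣∣-∣⇒%≡% (subst (k ∣_) (sub≡∣-∣ x y) k∣d))

%≡%⇒∣sub : .{{_ : NonZero k}} → k ∣ n → (x y : Fin n) → toℕ x % k ≡ toℕ y % k → k ∣ sub n x y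
%≡%⇒∣sub {k} k∣n x y eq =
  subst (k ∣_) (sym (sub≡∣-∣ x y)) (%≡%⇒∣∣-∣ (trans (%-remove-+ʳ (toℕ x) k∣n) eq))

n∣n² : ∀ n → n ∣ n ^ 2
n∣n² n = m∣m*n (n ^ 1)

prime∤1 : Prime p → ¬ p ∣ 1
prime∤1 pp p∣1 = ¬prime[1] (subst Prime (∣1⇒≡1 p∣1) pp)

prime∤prime : Prime p → Prime q → p ≢ q → ¬ p ∣ q
prime∤prime pp pq p≢q p∣q with prime⇒irreducible pq p∣q
... | inj₁ p≡1 = prime∤1 pp (subst (_∣ 1) (sym p≡1) (1∣ 1))
... | inj₂ p≡q = p≢q p≡q

prime∤* : Prime p → ¬ p ∣ a → ¬ p ∣ b → ¬ p ∣ a * b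
prime∤* {a = a} {b} pp p∤a p∤b p∣ab = [ p∤a , p∤b ] (euclidsLemma a b pp p∣ab)

prime∤^ : Prime p → ¬ p ∣ a → ∀ k → ¬ p ∣ a ^ k
prime∤^ pp p∤a zero    = prime∤1 pp
prime∤^ pp p∤a (suc k) = prime∤* pp p∤a (prime∤^ pp p∤a k)

prime∤a²b² : Prime p → Prime a → Prime b → p ≢ a → p ≢ b → ¬ p ∣ a ^ 2 * b ^ 2
prime∤a²b² pp pa pb p≢a p≢b =
  prime∤* pp (prime∤^ pp (prime∤prime pp pa p≢a) 2) (prime∤^ pp (prime∤prime pp pb p≢b) 2)

q∣d∧p∣d⇒q*p∣d : Prime p → ¬ p ∣ q → q ∣ d → p ∣ d → q * p ∣ d
q∣d∧p∣d⇒q*p∣d {p} {q} pp p∤q (divides e refl) p∣eq with euclidsLemma e q pp p∣eq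
... | inj₂ p∣q = contradiction p∣q p∤q
... | inj₁ (divides e′ refl) = divides e′ (reassoc e′ p q)
  where
  reassoc : ∀ x y z → x * y * z ≡ x * (z * y)
  reassoc = solve-∀

p^k∣m*n∧p∤n⇒p^k∣m : Prime p → ¬ p ∣ e → ∀ k → p ^ k ∣ j * e → p ^ k ∣ j
p^k∣m*n∧p∤n⇒p^k∣m {j = j} pp p∤e zero _ = 1∣ j
p^k∣m*n∧p∤n⇒p^k∣m {p} {e} {j} pp p∤e (suc k) p^k+1∣je
  with euclidsLemma j e pp (∣-trans (m∣m*n (p ^ k)) p^k+1∣je)
... | inj₂ p∣e = contradiction p∣e p∤e
... | inj₁ (divides j′ refl) = subst (p ^ suc k ∣_) (*-comm p j′)
  (*-monoʳ-∣ p (p^k∣m*n∧p∤n⇒p^k∣m pp p∤e k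
    (*-cancelˡ-∣ p {{prime⇒nonZero pp}} (subst (p * p ^ k ∣_) (reassoc j′ p e) p^k+1∣je))))
  where
  reassoc : ∀ x y z → x * y * z ≡ y * (x * z)
  reassoc = solve-∀

hasOrder-p²⇒∣∧∤ : Prime p → ¬ p ∣ q → HasOrder (q * p ^ 2) d (p ^ 2) → (q ∣ d) × (¬ p ∣ d)
hasOrder-p²⇒∣∧∤ {p} {q} {d} pp p∤q (_ , qp²∣p²d , minimal) = q∣d , p∤d
  where
  instance
    _ = prime⇒nonZero pp
    _ = m^n≢0 p 2
  q∣d : q ∣ d
  q∣d = *-cancelʳ-∣ (p ^ 2) (subst (q * p ^ 2 ∣_) (*-comm (p ^ 2) d) qp²∣p²d)
  p∤d : ¬ p ∣ d
  p∤d p∣d = minimal p (>-nonZero⁻¹ p) (m<m*n p (p ^ 1) p>1)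
    (subst₂ _∣_ (reassoc q p) (*-comm d p) (*-monoˡ-∣ p (q∣d∧p∣d⇒q*p∣d pp p∤q q∣d p∣d)))
    where
    p>1 : 1 < p ^ 1
    p>1 = subst (1 <_) (sym (*-identityʳ p)) (nonTrivial⇒n>1 p {{prime⇒nonTrivial pp}})
    reassoc : ∀ x y → x * y * y ≡ x * (y * (y * 1))
    reassoc = solve-∀

¬hasOrder-p² : Prime p → ¬ p ∣ q → (q ∣ d → p ∣ d) → ¬ HasOrder (q * p ^ 2) d (p ^ 2)
¬hasOrder-p² pp p∤q q∣d⇒p∣d ord = let q∣d , p∤d = hasOrder-p²⇒∣∧∤ pp p∤q ord in p∤d (q∣d⇒p∣d q∣d)

∣∧∤⇒hasOrder-p² : Prime p → q ∣ d → ¬ p ∣ d → HasOrder (q * p ^ 2) d (p ^ 2)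
∣∧∤⇒hasOrder-p² {p} {q} pp (divides e refl) p∤d = m^n>0 p 2 , divides e (reassoc p q e) , minimal
  where
  instance
    _ = prime⇒nonZero pp
    q≢0 : NonZero q
    q≢0 = ≢-nonZero λ { refl → p∤d (subst (p ∣_) (sym (*-zeroʳ e)) (p ∣0)) }
  reassoc : ∀ x y z → x * (x * 1) * (z * y) ≡ z * (y * (x * (x * 1)))
  reassoc = solve-∀
  minimal : ∀ j → 0 < j → j < p ^ 2 → ¬ (q * p ^ 2 ∣ j * (e * q))
  minimal j j>0 j<p² qp²∣jeq = <⇒≱ j<p² (∣⇒≤ {{>-nonZero j>0}} (p^k∣m*n∧p∤n⇒p^k∣m pp (p∤d ∘ ∣m⇒∣m*n q) 2
    (*-cancelʳ-∣ q (subst₂ _∣_ (*-comm q (p ^ 2)) (sym (*-assoc j e q)) qp²∣jeq))))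

module CayleyGraph {α β γ : ℕ} (pα : Prime α) (pβ : Prime β) (pγ : Prime γ)
                   (α<β : α < β) (β<γ : β < γ) where

  M : ℕ
  M = α ^ 2 * β ^ 2

  N : ℕ
  N = M * γ ^ 2

  instance
    _ = prime⇒nonZero pα
    _ = prime⇒nonZero pβ
    _ = prime⇒nonZero pγ
    _ = m*n≢0 (α ^ 2) (β ^ 2) {{m^n≢0 α 2}} {{m^n≢0 β 2}}

  α<γ : α < γ
  α<γ = <-trans α<β β<γ

  α∣M : α ∣ M
  α∣M = ∣m⇒∣m*n (β ^ 2) (n∣n² α)

  β∣M : β ∣ M
  β∣M = ∣n⇒∣m*n (α ^ 2) (n∣n² β)

  M∣N : M ∣ N
  M∣N = m∣m*n (γ ^ 2)

  α∣N : α ∣ N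
  α∣N = ∣-trans α∣M M∣N

  β∣N : β ∣ N
  β∣N = ∣-trans β∣M M∣N

  γ∣N : γ ∣ N
  γ∣N = ∣n⇒∣m*n M (n∣n² γ)

  γ∤M : ¬ γ ∣ M
  γ∤M = prime∤a²b² pγ pα pβ (>⇒≢ α<γ) (>⇒≢ β<γ)

  Q-α Q-β : ℕ
  Q-α = β ^ 2 * γ ^ 2
  Q-β = α ^ 2 * γ ^ 2

  N≡Q-α*α² : N ≡ Q-α * α ^ 2
  N≡Q-α*α² = rotate (α ^ 2) (β ^ 2) (γ ^ 2)
    where
    rotate : ∀ x y z → x * y * z ≡ y * z * x
    rotate = solve-∀

  N≡Q-β*β² : N ≡ Q-β * β ^ 2
  N≡Q-β*β² = swap (α ^ 2) (β ^ 2) (γ ^ 2)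
    where
    swap : ∀ x y z → x * y * z ≡ x * z * y
    swap = solve-∀

  Balanced : Pred (Fin N) _
  Balanced x = toℕ x % γ ≡ (toℕ x % α + toℕ x % β) % γ

  balanced? : Decidable Balanced
  balanced? x = toℕ x % γ ≟ (toℕ x % α + toℕ x % β) % γ

  S : Subset N
  S = subsetOf balanced?

  %<γ : .{{_ : NonZero p}} → p < γ → ∀ z → z % p < γ
  %<γ {p} p<γ z = <-trans (m%n<n z p) p<γ

  module _ {x y : Fin N} (x∈S : x ∈ S) (y∈S : y ∈ S) where

    private
      %α+%β≡ : toℕ x % γ ≡ toℕ y % γ →
        (toℕ x % α + toℕ x % β) % γ ≡ (toℕ y % α + toℕ y % β) % γ
      %α+%β≡ eq = trans (sym (∈-subsetOf⁻ balanced? x∈S)) (trans eq (∈-subsetOf⁻ balanced? y∈S))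

      %≡%-divisor : (k : ℕ) .{{_ : NonZero k}} → k ∣ N → k ∣ q → q ∣ sub N x y → toℕ x % k ≡ toℕ y % k
      %≡%-divisor k k∣N k∣q q∣d = ∣sub⇒%≡% k∣N x y (∣-trans k∣q q∣d)

    Q-α∣⇒α∣ : Q-α ∣ sub N x y → α ∣ sub N x y
    Q-α∣⇒α∣ Q∣d = %≡%⇒∣sub α∣N x y (%≡%∧<⇒≡ (%<γ α<γ (toℕ x)) (%<γ α<γ (toℕ y))
      (+-cancelʳ-%≡ {a = toℕ x % α} {b = toℕ y % α} (toℕ y % β) (begin
        (toℕ x % α + toℕ y % β) % γ ≡⟨ cong (λ b → (toℕ x % α + b) % γ) x%β≡y%β ⟨
        (toℕ x % α + toℕ x % β) % γ ≡⟨ %α+%β≡ x%γ≡y%γ ⟩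
        (toℕ y % α + toℕ y % β) % γ ∎)))
      where
      open ≡-Reasoning
      x%β≡y%β = %≡%-divisor β β∣N (∣m⇒∣m*n (γ ^ 2) (n∣n² β)) Q∣d
      x%γ≡y%γ = %≡%-divisor γ γ∣N (∣n⇒∣m*n (β ^ 2) (n∣n² γ)) Q∣d

    Q-β∣⇒β∣ : Q-β ∣ sub N x y → β ∣ sub N x y
    Q-β∣⇒β∣ Q∣d = %≡%⇒∣sub β∣N x y (%≡%∧<⇒≡ (%<γ β<γ (toℕ x)) (%<γ β<γ (toℕ y))
      (+-cancelˡ-%≡ {a = toℕ x % β} {b = toℕ y % β} (toℕ y % α) (begin
        (toℕ y % α + toℕ x % β) % γ ≡⟨ cong (λ a → (a + toℕ x % β) % γ) x%α≡y%α ⟨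
        (toℕ x % α + toℕ x % β) % γ ≡⟨ %α+%β≡ x%γ≡y%γ ⟩
        (toℕ y % α + toℕ y % β) % γ ∎)))
      where
      open ≡-Reasoning
      x%α≡y%α = %≡%-divisor α α∣N (∣m⇒∣m*n (γ ^ 2) (n∣n² α)) Q∣d
      x%γ≡y%γ = %≡%-divisor γ γ∣N (∣n⇒∣m*n (α ^ 2) (n∣n² γ)) Q∣d

    M∣⇒γ∣ : M ∣ sub N x y → γ ∣ sub N x y
    M∣⇒γ∣ M∣d = %≡%⇒∣sub γ∣N x y (begin
      toℕ x % γ                       ≡⟨ ∈-subsetOf⁻ balanced? x∈S ⟩
      (toℕ x % α + toℕ x % β) % γ     ≡⟨ cong₂ (λ a b → (a + b) % γ) x%α≡y%α x%β≡y%β ⟩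
      (toℕ y % α + toℕ y % β) % γ     ≡⟨ ∈-subsetOf⁻ balanced? y∈S ⟨
      toℕ y % γ                       ∎)
      where
      open ≡-Reasoning
      x%α≡y%α = %≡%-divisor α α∣N α∣M M∣d
      x%β≡y%β = %≡%-divisor β β∣N β∣M M∣d

  S-independent : Independent N α β γ S
  S-independent x y x∈S y∈S (_ , inj₁ ord) =
    ¬hasOrder-p² pα (prime∤a²b² pα pβ pγ (<⇒≢ α<β) (<⇒≢ α<γ)) (Q-α∣⇒α∣ x∈S y∈S)
      (subst (λ n → HasOrder n (sub N x y) (α ^ 2)) N≡Q-α*α² ord)
  S-independent x y x∈S y∈S (_ , inj₂ (inj₁ ord)) =
    ¬hasOrder-p² pβ (prime∤a²b² pβ pα pγ (>⇒≢ α<β) (<⇒≢ β<γ)) (Q-β∣⇒β∣ x∈S y∈S)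
      (subst (λ n → HasOrder n (sub N x y) (β ^ 2)) N≡Q-β*β² ord)
  S-independent x y x∈S y∈S (_ , inj₂ (inj₂ ord)) =
    ¬hasOrder-p² pγ γ∤M (M∣⇒γ∣ x∈S y∈S) ord

  Point : Set
  Point = Fin γ × Fin γ × Fin M

  γγM≡N : γ * γ * M ≡ N
  γγM≡N = reorder γ M
    where
    reorder : ∀ g m → g * g * m ≡ m * (g * (g * 1))
    reorder = solve-∀

  point : Point → Fin N
  point (s , t , r) = cast γγM≡N (combine (combine s t) r)

  coordinates : Fin N → Point
  coordinates x =
    let k , r = remQuot M (cast (sym γγM≡N) x)
        s , t = remQuot γ k
    in s , t , r

  point-coordinates : ∀ x → point (coordinates x) ≡ x
  point-coordinates x = begin
    cast γγM≡N (combine (combine s t) r) ≡⟨ cong (λ i → cast γγM≡N (combine i r)) (combine-remQuot {γ} γ k′) ⟩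
    cast γγM≡N (combine k′ r)             ≡⟨ cong (cast γγM≡N) (combine-remQuot {γ * γ} M x′) ⟩
    cast γγM≡N x′                        ≡⟨ cast-involutive γγM≡N (sym γγM≡N) x ⟩
    x                                    ∎
    where
    open ≡-Reasoning
    x′ : Fin (γ * γ * M)
    x′ = cast (sym γγM≡N) x
    k′ = proj₁ (remQuot {γ * γ} M x′)
    r = proj₂ (remQuot {γ * γ} M x′)
    s = proj₁ (remQuot {γ} γ k′)
    t = proj₂ (remQuot {γ} γ k′)

  point-injective : ∀ {u v} → point u ≡ point v → u ≡ v
  point-injective {s , t , r} {s′ , t′ , r′} eq
    with combine-injective (combine s t) r (combine s′ t′) r′ (cast-injective γγM≡N eq)
  ... | st≡s′t′ , refl with combine-injective s t s′ t′ st≡s′t′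
  ...   | refl , refl = refl

  toℕ-point : ∀ s t r → toℕ (point (s , t , r)) ≡ M * (γ * toℕ s + toℕ t) + toℕ r
  toℕ-point s t r = begin
    toℕ (cast γγM≡N (combine (combine s t) r)) ≡⟨ toℕ-cast γγM≡N (combine (combine s t) r) ⟩
    toℕ (combine (combine s t) r)              ≡⟨ toℕ-combine (combine s t) r ⟩
    M * toℕ (combine s t) + toℕ r              ≡⟨ cong (λ k → M * k + toℕ r) (toℕ-combine s t) ⟩
    M * (γ * toℕ s + toℕ t) + toℕ r            ∎
    where open ≡-Reasoning

  point-%-∣M : .{{_ : NonZero q}} → q ∣ M → ∀ s t r → toℕ (point (s , t , r)) % q ≡ toℕ r % q
  point-%-∣M {q} q∣M s t r =
    trans (cong (_% q) (toℕ-point s t r)) (%-remove-+ˡ (toℕ r) (∣m⇒∣m*n _ q∣M))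

  point-%γ : ∀ s t r → toℕ (point (s , t , r)) % γ ≡ (toℕ r + toℕ t * M) % γ
  point-%γ s t r = begin
    toℕ (point (s , t , r)) % γ                      ≡⟨ cong (_% γ) (toℕ-point s t r) ⟩
    (M * (γ * toℕ s + toℕ t) + toℕ r) % γ            ≡⟨ cong (_% γ) (regroup M γ (toℕ s) (toℕ t) (toℕ r)) ⟩
    (toℕ r + toℕ t * M + M * toℕ s * γ) % γ          ≡⟨ [m+kn]%n≡m%n (toℕ r + toℕ t * M) (M * toℕ s) γ ⟩
    (toℕ r + toℕ t * M) % γ                          ∎
    where
    open ≡-Reasoning
    regroup : ∀ m g s t r → m * (g * s + t) + r ≡ r + t * m + m * s * g
    regroup = solve-∀

  residue-injective : ∀ c {t t′ : Fin γ} → (c + toℕ t * M) % γ ≡ (c + toℕ t′ * M) % γ → t ≡ t′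
  residue-injective c {t} {t′} eq = toℕ-injective
    (%≡%∧<⇒≡ (toℕ<n t) (toℕ<n t′) (*-cancelʳ-%≡ pγ γ∤M (+-cancelˡ-%≡ c eq)))

  column-adjacent : ∀ s r {t t′} → t ≢ t′ → Adjacent N α β γ (point (s , t , r)) (point (s , t′ , r))
  column-adjacent s r {t} {t′} t≢t′ =
    t≢t′ ∘ ,-injectiveˡ ∘ ,-injectiveʳ ∘ point-injective ,
    inj₂ (inj₂ (∣∧∤⇒hasOrder-p² pγ M∣d γ∤d))
    where
    M∣d = %≡%⇒∣sub M∣N _ _ (trans (point-%-∣M ∣-refl s t r) (sym (point-%-∣M ∣-refl s t′ r)))
    γ∤d : ¬ γ ∣ sub N (point (s , t , r)) (point (s , t′ , r))
    γ∤d γ∣d = t≢t′ (residue-injective (toℕ r)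
      (trans (sym (point-%γ s t r)) (trans (∣sub⇒%≡% γ∣N _ _ γ∣d) (point-%γ s t′ r))))

  column : Point → Fin (γ * M)
  column (s , _ , r) = combine s r

  independent⇒column-injectiveOn : ∀ {T} → Independent N α β γ T → ∀ {u v} →
    point u ∈ T → point v ∈ T → column u ≡ column v → u ≡ v
  independent⇒column-injectiveOn ind {s , t , r} {s′ , t′ , r′} u∈T v∈T eq
    with combine-injective s r s′ r′ eq
  ... | refl , refl with t Fin.≟ t′
  ...   | yes refl = refl
  ...   | no t≢t′  = contradiction (column-adjacent s r t≢t′) (ind _ _ u∈T v∈T)

  independent⇒∣∣≤ : (T : Subset N) → Independent N α β γ T → ∣ T ∣ ≤ M * γ
  independent⇒∣∣≤ T ind = subst (∣ T ∣ ≤_) (trans (∣⊤∣≡n (γ * M)) (*-comm γ M))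
    (injectiveOn⇒∣p∣≤∣q∣ {Q = ⊤} (column ∘ coordinates) (λ _ → ∈⊤) column-coordinates-injectiveOn)
    where
    open ≡-Reasoning
    coordinates∈T : ∀ {x} → x ∈ T → point (coordinates x) ∈ T
    coordinates∈T {x} = subst (_∈ T) (sym (point-coordinates x))
    column-coordinates-injectiveOn : ∀ {x y} → x ∈ T → y ∈ T →
      column (coordinates x) ≡ column (coordinates y) → x ≡ y
    column-coordinates-injectiveOn {x} {y} x∈T y∈T eq = begin
      x                      ≡⟨ point-coordinates x ⟨
      point (coordinates x)  ≡⟨ cong point (independent⇒column-injectiveOn ind (coordinates∈T x∈T) (coordinates∈T y∈T) eq) ⟩
      point (coordinates y)  ≡⟨ point-coordinates y ⟩
      y                      ∎

  balanced-point : ∀ s t r → (toℕ r + toℕ t * M) % γ ≡ (toℕ r % α + toℕ r % β) % γ →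
    point (s , t , r) ∈ S
  balanced-point s t r eq = ∈-subsetOf⁺ balanced? (begin
    toℕ x % γ                   ≡⟨ point-%γ s t r ⟩
    (toℕ r + toℕ t * M) % γ     ≡⟨ eq ⟩
    (toℕ r % α + toℕ r % β) % γ ≡⟨ cong₂ (λ a b → (a + b) % γ) (point-%-∣M α∣M s t r) (point-%-∣M β∣M s t r) ⟨
    (toℕ x % α + toℕ x % β) % γ ∎)
    where
    open ≡-Reasoning
    x = point (s , t , r)

  balancing-offset : (r : Fin M) → ∃ λ t → (toℕ r + toℕ t * M) % γ ≡ (toℕ r % α + toℕ r % β) % γ
  balancing-offset r = map₂ mod≡mod⇒%≡%
    (injective⇒surjective (λ t → (toℕ r + toℕ t * M) mod γ) (residue-injective (toℕ r) ∘ mod≡mod⇒%≡%)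
      ((toℕ r % α + toℕ r % β) mod γ))

  transversal : Fin (γ * M) → Point
  transversal i = let s , r = remQuot {γ} M i in s , proj₁ (balancing-offset r) , r

  M*γ≤∣S∣ : M * γ ≤ ∣ S ∣
  M*γ≤∣S∣ = subst (_≤ ∣ S ∣) (trans (∣⊤∣≡n (γ * M)) (*-comm γ M))
    (injectiveOn⇒∣p∣≤∣q∣ {P = ⊤} (point ∘ transversal) (λ {i} _ → transversal∈S i)
      (λ {i} {j} _ _ eq → begin
        i                         ≡⟨ combine-remQuot {γ} M i ⟨
        column (transversal i)    ≡⟨ cong column (point-injective eq) ⟩
        column (transversal j)    ≡⟨ combine-remQuot {γ} M j ⟩
        j                         ∎))
    where
    open ≡-Reasoning
    transversal∈S : ∀ i → point (transversal i) ∈ S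
    transversal∈S i = let s , r = remQuot {γ} M i in
      balanced-point s (proj₁ (balancing-offset r)) r (proj₂ (balancing-offset r))

corollary2p16 : (α β γ : ℕ) → Prime α → Prime β → Prime γ → α < β → β < γ →
    IndependenceNumber ((α ^ 2) * (β ^ 2) * (γ ^ 2)) α β γ ((α ^ 2) * (β ^ 2) * γ)
corollary2p16 α β γ pα pβ pγ α<β β<γ =
  (S , S-independent , ≤-antisym (independent⇒∣∣≤ S S-independent) M*γ≤∣S∣) , independent⇒∣∣≤
  where open CayleyGraph pα pβ pγ α<β β<γ
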